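{- Let $s\in\mathbb N$ and $d\ge1$. For $X=(x_1,\dots,x_d),Y=(y_1,\dots,y_d)\in U^d=[0,1)^d$ define $$\chi^{(s)}(B_Y,X)=2^{ -d}\sum_{A\in I_s^d}(-1)^{\varkappa(A)}\chi(\Pi_A,X^{(s)}\oplus Y^{(s)})\,r_A(Y),\qquad \varepsilon^{(s)}(X,Y)=\chi(B_Y,X)-\chi^{(s)}(B_Y,X),$$ where $B_Y=[0,y_1)\times\dots\times[0,y_d)$. Then for all $X,Y\in U^d$, $$0\le\chi^{(s)}(B_Y,X)\le1\quad\text{and}\quad|\varepsilon^{(s)}(X,Y)|\le\frac12\sum_{j=1}^d\delta^{(s)}(x_j,y_j).$$
   Context: $\chi(\mathcal E,\cdot)$ is the characteristic function of $\mathcal E$. Every $y\in[0,1)$ has a unique dyadic expansion $y=\sum_{a\ge1}\eta_a(y)2^{ -a}$, $\eta_a(y)\in\{0,1\}$, with infinitely many zero digits. $r_a(y)=(-1)^{\eta_a(y)}$ for $a\ge1$, $r_0\equiv1$; $r_A(Y)=\prod_j r_{a_j}(y_j)$ for $A=(a_1,\dots,a_d)$. $I_s=\{0,\dots,s\}$. $y^{(s)}=\sum_{a=1}^s\eta_a(y)2^{ -a}$ and $Y^{(s)}=(y^{(s)}_1,\dots,y^{(s)}_d)$. For dyadic rationals $u,v\in\mathbb Q(2^s)=\{m2^{ -s}:0\le m<2^s\}$, $u\oplus v$ is defined by digitwise addition mod 2, and coordinatewise for vectors. $\Pi_0=[0,1)$, $\Pi_a=[2^{ -a},2^{1-a})$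 for $a\ge1$, $\Pi_A=\Pi_{a_1}\times\dots\times\Pi_{a_d}$. $\varkappa(A)$ is the number of nonzero entries of $A$. $\delta^{(s)}(x,y)=1$ if $x^{(s)}=y^{(s)}$ and $0$ otherwise. -}

module Defs where

open import Data.Nat using (ℕ; zero; suc; _≤_; _<_; _^_; NonZero)
open import Data.Nat.Properties using (_<?_; m^n≢0)
open import Data.Bool using (Bool; true; false; not; _∧_; _xor_; if_then_else_)
open import Data.Fin using (Fin; zero; suc; toℕ)
open import Data.Vec.Functional using (_∷_)
open import Data.Product using (Σ; ∃-syntax; _×_)
open import Data.Sum using (_⊎_)
open import Relation.Nullary using (¬_; does)
open import Relation.Binary.PropositionalEquality using (_≡_)
open import Data.Integer using (+_)
open import Data.Rational using (ℚ; 0ℚ; 1ℚ; _+_; _*_; -_; _/_)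

-- A point y ∈ [0,1), given by its dyadic digits.
-- η i is the digit η_{i+1}(y) (0-indexed storage of digits η_1, η_2, …;
-- true = 1, false = 0). Infinitely many zero digits, so the expansion is the
-- unique one of the paper.
record U : Set where
  field
    η        : ℕ → Bool
    infZeros : ∀ n → ∃[ m ] (n ≤ m × η m ≡ false)
open U public

-- The real order on [0,1) read off the (unique) dyadic expansions:
-- x < y iff at the first differing digit x has 0 and y has 1.
_<U_ : U → U → Set
x <U y = ∃[ k ] ((∀ i → i < k → η x i ≡ η y i) × η x k ≡ false × η y k ≡ true)

-- Digits of x^(s) ⊕ y^(s) (0-indexed): xor of the first s digits, zero after.
oplusDigits : ℕ → U → U → ℕ → Bool
oplusDigits s x y i = if does (i <? s) then (η x i xor η y i) else false

-- z ∈ Π_{k+1} = [2^{-(k+1)}, 2^{-k}) iff digits 1..k of z are 0 and digit k+1 is 1.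
leadAt : ℕ → (ℕ → Bool) → Bool
leadAt zero    z = z 0
leadAt (suc k) z = not (z 0) ∧ leadAt k (λ i → z (suc i))

inΠ : ℕ → (ℕ → Bool) → Bool
inΠ zero    z = true
inΠ (suc k) z = leadAt k z

boolℚ : Bool → ℚ
boolℚ true  = 1ℚ
boolℚ false = 0ℚ

r : ℕ → U → ℚ
r zero    y = 1ℚ
r (suc k) y = if η y k then - 1ℚ else 1ℚ

sumFin : (n : ℕ) → (Fin n → ℚ) → ℚ
sumFin zero    f = 0ℚ
sumFin (suc n) f = f zero + sumFin n (λ i → f (suc i))

prodFin : (n : ℕ) → (Fin n → ℚ) → ℚ
prodFin zero    f = 1ℚ
prodFin (suc n) f = f zero * prodFin n (λ i → f (suc i))

-- sum over all A ∈ I_s^d, A represented as Fin d → Fin (suc s)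
sumMulti : (s d : ℕ) → ((Fin d → Fin (suc s)) → ℚ) → ℚ
sumMulti s zero    f = f (λ ())
sumMulti s (suc d) f = sumFin (suc s) (λ a → sumMulti s d (λ A → f (a ∷ A)))

ϰ : (s d : ℕ) → (Fin d → Fin (suc s)) → ℕ
ϰ s zero    A = 0
ϰ s (suc d) A with A zero
... | zero  = ϰ s d (λ i → A (suc i))
... | suc _ = suc (ϰ s d (λ i → A (suc i)))

negOnePow : ℕ → ℚ
negOnePow zero    = 1ℚ
negOnePow (suc n) = - negOnePow n

chiS : (s d : ℕ) → (Fin d → U) → (Fin d → U) → ℚ
chiS s d X Y =
  ((+ 1) / (2 ^ d)) {{2^d≢0}} *
  sumMulti s d (λ A →
    negOnePow (ϰ s d A) *
    prodFin d (λ j → boolℚ (inΠ (toℕ (A j)) (oplusDigits s (X j) (Y j)))) *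
    prodFin d (λ j → r (toℕ (A j)) (Y j)))
  where
  2^d≢0 : NonZero (2 ^ d)
  2^d≢0 = m^n≢0 2 d

InB : (d : ℕ) → (Fin d → U) → (Fin d → U) → Set
InB d X Y = ∀ j → X j <U Y j

IsChiB : (d : ℕ) → (Fin d → U) → (Fin d → U) → ℚ → Set
IsChiB d X Y q = (InB d X Y × q ≡ 1ℚ) ⊎ (¬ InB d X Y × q ≡ 0ℚ)

firstEq : ℕ → (ℕ → Bool) → (ℕ → Bool) → Bool
firstEq zero    x y = true
firstEq (suc s) x y = not (x 0 xor y 0) ∧ firstEq s (λ i → x (suc i)) (λ i → y (suc i))

δ : ℕ → U → U → ℚ
δ s x y = boolℚ (firstEq s (η x) (η y))

module Submission where

-- The summand of χ^(s)(B_Y, X) indexed by A ∈ I_s^d is a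
-- product over the coordinates j, so the sum factorises:
--   χ^(s)(B_Y, X) = Π_j ½ S(x_j, y_j),
--   S(x, y) = Σ_{a ∈ I_s} (-1)^{[a ≠ 0]} χ(Π_a, x^(s) ⊕ y^(s)) r_a(y).
-- In S only a = 0 and a = k+1, for k the first digit where x and y differ,
-- survive, so ½ S(x, y) is 1, ½ or 0 according as x^(s) < y^(s),
-- x^(s) = y^(s) or x^(s) > y^(s) (the position of x relative to y).  Hence
-- χ^(s) is a product of numbers in [0,1].  For the error, χ(B_Y, X) is a
-- product of indicators b_j ∈ {0,1} compatible with the positions, and for
-- factors in [0,1] we have |Π b_j - Π v_j| ≤ Σ |b_j - v_j|, where
-- |b_j - v_j| = ½ δ^(s)(x_j, y_j).

open import Defs
open import Data.Nat using (ℕ; suc)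
open import Data.Fin using (Fin)
open import Data.Product using (_×_)
open import Data.Rational using (ℚ; 0ℚ; 1ℚ; ½; _≤_; _*_; _-_; ∣_∣)

open import Data.Nat as ℕ using (zero; _<_; _^_; z≤n; s≤s; NonZero)
open import Data.Nat.Properties using (_<?_; m^n≢0)
open import Data.Integer as ℤ using (1ℤ)
import Data.Integer.Properties as ℤ
open import Data.Integer.GCD using (gcd-zeroˡ)
open import Data.Rational using (mkℚ; ↥_; ↧_; _+_; -_; _/_; nonNegative)
open import Data.Rational.Properties
  using ( *-zeroˡ; *-zeroʳ; *-identityˡ; *-identityʳ; *-distribˡ-+; *-distribʳ-+
        ; +-identityˡ; neg-distribˡ-*; ↥-/; ↧-/; /-cong; _≤?_; ≤-refl; module ≤-Reasoning
        ; +-mono-≤; +-monoʳ-≤; *-monoˡ-≤-nonNeg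
        ; ∣p+q∣≤∣p∣+∣q∣; ∣p*q∣≡∣p∣*∣q∣; 0≤p⇒∣p∣≡p; ∣-∣-nonNeg )
open import Data.Rational.Solver using (module +-*-Solver)
open import Data.Fin using (zero; suc; toℕ)
open import Data.Fin.Properties using (¬∀⟶∃¬)
open import Data.Bool using (Bool; true; false; _xor_; if_then_else_)
open import Data.Vec.Functional using (_∷_)
open import Data.Product using (∃-syntax; _,_; proj₁; proj₂)
open import Data.Empty using (⊥-elim)
open import Data.Sum using (_⊎_; inj₁; inj₂)
open import Function using (_∘_)
open import Relation.Nullary using (¬_; Dec; yes; no)
open import Relation.Nullary.Decidable using (dec-true; toWitness)
open import Relation.Binary.PropositionalEquality
  using (_≡_; _≢_; refl; sym; trans; cong; cong₂; subst; module ≡-Reasoning)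

sumFin-cong : ∀ n {f g : Fin n → ℚ} → (∀ i → f i ≡ g i) → sumFin n f ≡ sumFin n g
sumFin-cong zero    eq = refl
sumFin-cong (suc n) eq = cong₂ _+_ (eq zero) (sumFin-cong n (eq ∘ suc))

prodFin-cong : ∀ n {f g : Fin n → ℚ} → (∀ i → f i ≡ g i) → prodFin n f ≡ prodFin n g
prodFin-cong zero    eq = refl
prodFin-cong (suc n) eq = cong₂ _*_ (eq zero) (prodFin-cong n (eq ∘ suc))

sumMulti-cong : ∀ s d {f g : (Fin d → Fin (suc s)) → ℚ} → (∀ A → f A ≡ g A) →
  sumMulti s d f ≡ sumMulti s d g
sumMulti-cong s zero    eq = eq _
sumMulti-cong s (suc d) eq = sumFin-cong (suc s) (λ a → sumMulti-cong s d (λ A → eq (a ∷ A)))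

sumFin-*ˡ : ∀ n c (f : Fin n → ℚ) → sumFin n (λ i → c * f i) ≡ c * sumFin n f
sumFin-*ˡ zero    c f = sym (*-zeroʳ c)
sumFin-*ˡ (suc n) c f = trans (cong ((c * f zero) +_) (sumFin-*ˡ n c (f ∘ suc)))
                              (sym (*-distribˡ-+ c (f zero) _))

sumFin-*ʳ : ∀ n c (f : Fin n → ℚ) → sumFin n (λ i → f i * c) ≡ sumFin n f * c
sumFin-*ʳ zero    c f = sym (*-zeroˡ c)
sumFin-*ʳ (suc n) c f = trans (cong ((f zero * c) +_) (sumFin-*ʳ n c (f ∘ suc)))
                              (sym (*-distribʳ-+ c (f zero) _))

sumMulti-*ˡ : ∀ s d c (f : (Fin d → Fin (suc s)) → ℚ) →
  sumMulti s d (λ A → c * f A) ≡ c * sumMulti s d f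
sumMulti-*ˡ s zero    c f = refl
sumMulti-*ˡ s (suc d) c f =
  trans (sumFin-cong (suc s) (λ a → sumMulti-*ˡ s d c (λ A → f (a ∷ A))))
        (sumFin-*ˡ (suc s) c (λ a → sumMulti s d (λ A → f (a ∷ A))))

sumFin-zero : ∀ n {f : Fin n → ℚ} → (∀ i → f i ≡ 0ℚ) → sumFin n f ≡ 0ℚ
sumFin-zero zero    eq = refl
sumFin-zero (suc n) eq = cong₂ _+_ (eq zero) (sumFin-zero n (eq ∘ suc))

open +-*-Solver

prodFin-* : ∀ n (f g : Fin n → ℚ) →
  prodFin n (λ i → f i * g i) ≡ prodFin n f * prodFin n g
prodFin-* zero    f g = refl
prodFin-* (suc n) f g =
  trans (cong ((f zero * g zero) *_) (prodFin-* n (f ∘ suc) (g ∘ suc)))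
        (interchange (f zero) (g zero) (prodFin n (f ∘ suc)) (prodFin n (g ∘ suc)))
  where
  interchange : ∀ a b c e → (a * b) * (c * e) ≡ (a * c) * (b * e)
  interchange = solve 4 (λ a b c e → (a :* b) :* (c :* e) := (a :* c) :* (b :* e)) refl

prodFin-ones : ∀ n {f : Fin n → ℚ} → (∀ i → f i ≡ 1ℚ) → prodFin n f ≡ 1ℚ
prodFin-ones zero    eq = refl
prodFin-ones (suc n) eq = cong₂ _*_ (eq zero) (prodFin-ones n (eq ∘ suc))

prodFin-zero : ∀ n {f : Fin n → ℚ} (j : Fin n) → f j ≡ 0ℚ → prodFin n f ≡ 0ℚ
prodFin-zero (suc n) {f} zero    eq = trans (cong (_* prodFin n (f ∘ suc)) eq) (*-zeroˡ (prodFin n (f ∘ suc)))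
prodFin-zero (suc n) {f} (suc j) eq = trans (cong (f zero *_) (prodFin-zero n j eq)) (*-zeroʳ (f zero))

sumMulti-prodFin : ∀ s d (w : Fin d → Fin (suc s) → ℚ) →
  sumMulti s d (λ A → prodFin d (λ j → w j (A j))) ≡ prodFin d (λ j → sumFin (suc s) (w j))
sumMulti-prodFin s zero    w = refl
sumMulti-prodFin s (suc d) w = begin
  sumFin (suc s) (λ a → sumMulti s d (λ A → w zero a * prodFin d (λ j → w (suc j) (A j))))
    ≡⟨ sumFin-cong (suc s) (λ a → sumMulti-*ˡ s d (w zero a) (λ A → prodFin d (λ j → w (suc j) (A j)))) ⟩
  sumFin (suc s) (λ a → w zero a * sumMulti s d (λ A → prodFin d (λ j → w (suc j) (A j))))
    ≡⟨ sumFin-cong (suc s) (λ a → cong (w zero a *_) (sumMulti-prodFin s d (w ∘ suc))) ⟩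
  sumFin (suc s) (λ a → w zero a * rest)
    ≡⟨ sumFin-*ʳ (suc s) rest (w zero) ⟩
  sumFin (suc s) (w zero) * rest ∎
  where
  open ≡-Reasoning
  rest : ℚ
  rest = prodFin d (λ j → sumFin (suc s) (w (suc j)))

sgn : ∀ {s} → Fin (suc s) → ℚ
sgn zero    = 1ℚ
sgn (suc _) = - 1ℚ

negOnePow-ϰ : ∀ s d (A : Fin d → Fin (suc s)) →
  negOnePow (ϰ s d A) ≡ prodFin d (λ j → sgn (A j))
negOnePow-ϰ s zero    A = refl
negOnePow-ϰ s (suc d) A with A zero
... | zero  = trans (negOnePow-ϰ s d (A ∘ suc)) (sym (*-identityˡ signs))
  where signs = prodFin d (λ j → sgn (A (suc j)))
... | suc _ = trans (cong -_ (trans (negOnePow-ϰ s d (A ∘ suc)) (sym (*-identityˡ signs))))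
                    (neg-distribˡ-* 1ℚ signs)
  where signs = prodFin d (λ j → sgn (A (suc j)))

signed-sum-factorises : ∀ s d (u v : Fin d → Fin (suc s) → ℚ) →
  sumMulti s d (λ A → negOnePow (ϰ s d A) * prodFin d (λ j → u j (A j))
                                          * prodFin d (λ j → v j (A j)))
  ≡ prodFin d (λ j → sumFin (suc s) (λ a → sgn a * u j a * v j a))
signed-sum-factorises s d u v =
  trans (sumMulti-cong s d signed-product)
        (sumMulti-prodFin s d (λ j a → sgn a * u j a * v j a))
  where
  open ≡-Reasoning
  signed-product : ∀ A →
    negOnePow (ϰ s d A) * prodFin d (λ j → u j (A j)) * prodFin d (λ j → v j (A j))
    ≡ prodFin d (λ j → sgn (A j) * u j (A j) * v j (A j))
  signed-product A = begin
    negOnePow (ϰ s d A) * prodFin d (λ j → u j (A j)) * prodFin d (λ j → v j (A j))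
      ≡⟨ cong (λ σ → σ * prodFin d (λ j → u j (A j)) * prodFin d (λ j → v j (A j)))
              (negOnePow-ϰ s d A) ⟩
    prodFin d (λ j → sgn (A j)) * prodFin d (λ j → u j (A j)) * prodFin d (λ j → v j (A j))
      ≡⟨ cong (_* prodFin d (λ j → v j (A j))) (sym (prodFin-* d _ _)) ⟩
    prodFin d (λ j → sgn (A j) * u j (A j)) * prodFin d (λ j → v j (A j))
      ≡⟨ sym (prodFin-* d _ _) ⟩
    prodFin d (λ j → sgn (A j) * u j (A j) * v j (A j)) ∎

↥-unitFraction : ∀ n .{{_ : NonZero n}} → ↥ (1ℤ / n) ≡ 1ℤ
↥-unitFraction n = trans (sym (ℤ.*-identityʳ _))
  (trans (cong (↥ (1ℤ / n) ℤ.*_) (sym (gcd-zeroˡ (ℤ.+ n)))) (↥-/ 1ℤ n))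

↧-unitFraction : ∀ n .{{_ : NonZero n}} → ↧ (1ℤ / n) ≡ ℤ.+ n
↧-unitFraction n = trans (sym (ℤ.*-identityʳ _))
  (trans (cong (↧ (1ℤ / n) ℤ.*_) (sym (gcd-zeroˡ (ℤ.+ n)))) (↧-/ 1ℤ n))

half-unitFraction : ∀ n .{{_ : NonZero n}} .{{_ : NonZero (2 ℕ.* n)}} →
  ½ * (1ℤ / n) ≡ 1ℤ / (2 ℕ.* n)
half-unitFraction n = halve (1ℤ / n) (↥-unitFraction n) (↧-unitFraction n)
  where
  halve : ∀ q → ↥ q ≡ 1ℤ → ↧ q ≡ ℤ.+ n → ½ * q ≡ 1ℤ / (2 ℕ.* n)
  halve (mkℚ a _ _) num den =
    /-cong (trans (ℤ.*-identityˡ a) num) (cong (2 ℕ.*_) (cong ℤ.∣_∣ den))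

unitFraction-2^ : ∀ d → (1ℤ / (2 ^ d)) {{m^n≢0 2 d}} ≡ prodFin d (λ _ → ½)
unitFraction-2^ zero    = refl
unitFraction-2^ (suc d) =
  trans (sym (half-unitFraction (2 ^ d) {{m^n≢0 2 d}} {{m^n≢0 2 (suc d)}}))
        (cong (½ *_) (unitFraction-2^ d))

shift : (ℕ → Bool) → ℕ → Bool
shift x i = x (suc i)

data Position : Set where
  below tie above : Position

compareDigits : ℕ → (ℕ → Bool) → (ℕ → Bool) → Position
compareDigits zero    x y = tie
compareDigits (suc s) x y with x 0 | y 0
... | false | true  = below
... | true  | false = above
... | true  | true  = compareDigits s (shift x) (shift y)
... | false | false = compareDigits s (shift x) (shift y)

position : ℕ → U → U → Position
position s x y = compareDigits s (η x) (η y)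

value : Position → ℚ
value below = 1ℚ
value tie   = ½
value above = 0ℚ

twice : Position → ℚ
twice p = value p + value p

tieIndicator : Position → ℚ
tieIndicator tie = 1ℚ
tieIndicator _   = 0ℚ

leadingSum : ℕ → (ℕ → Bool) → (ℕ → Bool) → ℚ
leadingSum n z y =
  sumFin n (λ k → (- 1ℚ * boolℚ (leadAt (toℕ k) z)) * (if y (toℕ k) then - 1ℚ else 1ℚ))

-- If the first n digits of z are those of x ⊕ y, then z leads at the first
-- differing digit k, so only the term -r_{k+1}(y) survives (it is +1 if
-- x < y there, -1 if x > y); with the term a = 0 this is twice the value of
-- the position.  Equal first digits contribute 0 and pass to the tails.
leadingSum-position : ∀ n (z x y : ℕ → Bool) → (∀ i → i < n → z i ≡ (x i xor y i)) →
  1ℚ + leadingSum n z y ≡ twice (compareDigits n x y)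
leadingSum-position zero    z x y zdigits = refl
leadingSum-position (suc n) z x y zdigits with x 0 | y 0 | z 0 | zdigits 0 (s≤s z≤n)
... | true  | true  | false | refl =
  trans (cong (1ℚ +_) (+-identityˡ (leadingSum n (shift z) (shift y))))
        (leadingSum-position n (shift z) (shift x) (shift y) (λ i i<n → zdigits (suc i) (s≤s i<n)))
... | false | false | false | refl =
  trans (cong (1ℚ +_) (+-identityˡ (leadingSum n (shift z) (shift y))))
        (leadingSum-position n (shift z) (shift x) (shift y) (λ i i<n → zdigits (suc i) (s≤s i<n)))
... | false | true  | true  | refl =
  cong (λ t → 1ℚ + ((- 1ℚ * 1ℚ) * - 1ℚ + t))
       (sumFin-zero n (λ k → *-zeroˡ (if y (suc (toℕ k)) then - 1ℚ else 1ℚ)))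
... | true  | false | true  | refl =
  cong (λ t → 1ℚ + ((- 1ℚ * 1ℚ) * 1ℚ + t))
       (sumFin-zero n (λ k → *-zeroˡ (if y (suc (toℕ k)) then - 1ℚ else 1ℚ)))

digitSum : ℕ → U → U → ℚ
digitSum s x y = sumFin (suc s) (λ a → sgn a * boolℚ (inΠ (toℕ a) (oplusDigits s x y)) * r (toℕ a) y)

oplusDigits-xor : ∀ s x y i → i < s → oplusDigits s x y i ≡ (η x i xor η y i)
oplusDigits-xor s x y i i<s rewrite dec-true (i <? s) i<s = refl

half-digitSum : ∀ s x y → ½ * digitSum s x y ≡ value (position s x y)
half-digitSum s x y =
  trans (cong (½ *_) (leadingSum-position s (oplusDigits s x y) (η x) (η y) (oplusDigits-xor s x y)))
        (half-twice (position s x y))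
  where
  half-twice : ∀ p → ½ * twice p ≡ value p
  half-twice below = refl
  half-twice tie   = refl
  half-twice above = refl

_≺_ : (ℕ → Bool) → (ℕ → Bool) → Set
x ≺ y = ∃[ k ] ((∀ i → i < k → x i ≡ y i) × x k ≡ false × y k ≡ true)

≺-cons : ∀ {x y} → x 0 ≡ y 0 → shift x ≺ shift y → x ≺ y
≺-cons {x} {y} head (k , agree , xk , yk) = suc k , agree′ , xk , yk
  where
  agree′ : ∀ i → i < suc k → x i ≡ y i
  agree′ zero    _         = head
  agree′ (suc i) (s≤s i<k) = agree i i<k

≺-tail : ∀ {x y} → x 0 ≡ y 0 → x ≺ y → shift x ≺ shift y
≺-tail head (zero , _ , x0 , y0) with trans (sym x0) (trans head y0)
... | ()
≺-tail head (suc k , agree , xk , yk) = k , (λ i i<k → agree (suc i) (s≤s i<k)) , xk , yk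

≺-head : ∀ {x y} → x ≺ y → x 0 ≡ true → y 0 ≡ true
≺-head (zero  , _     , x0 , _) x0′ with trans (sym x0) x0′
... | ()
≺-head (suc k , agree , _  , _) x0′ = trans (sym (agree 0 (s≤s z≤n))) x0′

below⇒≺ : ∀ s x y → compareDigits s x y ≡ below → x ≺ y
below⇒≺ zero    x y ()
below⇒≺ (suc s) x y isBelow with x 0 in x0 | y 0 in y0
... | false | true  = 0 , (λ _ ()) , x0 , y0
... | true  | true  = ≺-cons (trans x0 (sym y0)) (below⇒≺ s (shift x) (shift y) isBelow)
... | false | false = ≺-cons (trans x0 (sym y0)) (below⇒≺ s (shift x) (shift y) isBelow)

above⇒¬≺ : ∀ s x y → compareDigits s x y ≡ above → ¬ x ≺ y
above⇒¬≺ zero    x y ()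
above⇒¬≺ (suc s) x y isAbove x≺y with x 0 in x0 | y 0 in y0
... | true  | false with trans (sym y0) (≺-head x≺y x0)
...   | ()
above⇒¬≺ (suc s) x y isAbove x≺y | true  | true =
  above⇒¬≺ s (shift x) (shift y) isAbove (≺-tail (trans x0 (sym y0)) x≺y)
above⇒¬≺ (suc s) x y isAbove x≺y | false | false =
  above⇒¬≺ s (shift x) (shift y) isAbove (≺-tail (trans x0 (sym y0)) x≺y)

firstEq-tie : ∀ s x y → boolℚ (firstEq s x y) ≡ tieIndicator (compareDigits s x y)
firstEq-tie zero    x y = refl
firstEq-tie (suc s) x y with x 0 | y 0
... | true  | true  = firstEq-tie s (shift x) (shift y)
... | false | false = firstEq-tie s (shift x) (shift y)
... | true  | false = refl
... | false | true  = refl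

InUnit : ℚ → Set
InUnit q = 0ℚ ≤ q × q ≤ 1ℚ

0≤½ : 0ℚ ≤ ½
0≤½ = toWitness {a? = 0ℚ ≤? ½} _

½≤1 : ½ ≤ 1ℚ
½≤1 = toWitness {a? = ½ ≤? 1ℚ} _

0≤1 : 0ℚ ≤ 1ℚ
0≤1 = toWitness {a? = 0ℚ ≤? 1ℚ} _

unit-* : ∀ {p q} → InUnit p → InUnit q → InUnit (p * q)
unit-* {p} {q} (0≤p , p≤1) (0≤q , q≤1) = 0≤pq , pq≤1
  where
  open ≤-Reasoning
  0≤pq : 0ℚ ≤ p * q
  0≤pq = begin
    0ℚ     ≡⟨ sym (*-zeroʳ p) ⟩
    p * 0ℚ ≤⟨ *-monoˡ-≤-nonNeg p {{nonNegative 0≤p}} 0≤q ⟩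
    p * q  ∎
  pq≤1 : p * q ≤ 1ℚ
  pq≤1 = begin
    p * q  ≤⟨ *-monoˡ-≤-nonNeg p {{nonNegative 0≤p}} q≤1 ⟩
    p * 1ℚ ≡⟨ *-identityʳ p ⟩
    p      ≤⟨ p≤1 ⟩
    1ℚ     ∎

prodFin-unit : ∀ n {f : Fin n → ℚ} → (∀ i → InUnit (f i)) → InUnit (prodFin n f)
prodFin-unit zero    unit = 0≤1 , ≤-refl
prodFin-unit (suc n) unit = unit-* (unit zero) (prodFin-unit n (unit ∘ suc))

∣*unit∣≤ : ∀ u {v} → InUnit v → ∣ u * v ∣ ≤ ∣ u ∣
∣*unit∣≤ u {v} (0≤v , v≤1) = begin
  ∣ u * v ∣     ≡⟨ ∣p*q∣≡∣p∣*∣q∣ u v ⟩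
  ∣ u ∣ * ∣ v ∣ ≡⟨ cong (∣ u ∣ *_) (0≤p⇒∣p∣≡p 0≤v) ⟩
  ∣ u ∣ * v     ≤⟨ *-monoˡ-≤-nonNeg ∣ u ∣ {{∣-∣-nonNeg u}} v≤1 ⟩
  ∣ u ∣ * 1ℚ    ≡⟨ *-identityʳ ∣ u ∣ ⟩
  ∣ u ∣         ∎
  where open ≤-Reasoning

∣*-*∣≤ : ∀ a b p q → InUnit b → InUnit p → ∣ a * p - b * q ∣ ≤ ∣ a - b ∣ + ∣ p - q ∣
∣*-*∣≤ a b p q unitB unitP = begin
  ∣ a * p - b * q ∣                   ≡⟨ cong ∣_∣ (regroup a b p q) ⟩
  ∣ (a - b) * p + (p - q) * b ∣       ≤⟨ ∣p+q∣≤∣p∣+∣q∣ ((a - b) * p) ((p - q) * b) ⟩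
  ∣ (a - b) * p ∣ + ∣ (p - q) * b ∣   ≤⟨ +-mono-≤ (∣*unit∣≤ (a - b) unitP) (∣*unit∣≤ (p - q) unitB) ⟩
  ∣ a - b ∣ + ∣ p - q ∣               ∎
  where
  open ≤-Reasoning
  regroup : ∀ a b p q → a * p - b * q ≡ (a - b) * p + (p - q) * b
  regroup = solve 4 (λ a b p q → a :* p :- b :* q := (a :- b) :* p :+ (p :- q) :* b) refl

prodFin-distance : ∀ n {f g : Fin n → ℚ} → (∀ i → InUnit (f i)) → (∀ i → InUnit (g i)) →
  ∣ prodFin n f - prodFin n g ∣ ≤ sumFin n (λ i → ∣ f i - g i ∣)
prodFin-distance zero    unitF unitG = ≤-refl
prodFin-distance (suc n) {f} {g} unitF unitG = begin
  ∣ f zero * prodFin n (f ∘ suc) - g zero * prodFin n (g ∘ suc) ∣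
    ≤⟨ ∣*-*∣≤ (f zero) (g zero) _ _ (unitG zero) (prodFin-unit n (unitF ∘ suc)) ⟩
  ∣ f zero - g zero ∣ + ∣ prodFin n (f ∘ suc) - prodFin n (g ∘ suc) ∣
    ≤⟨ +-monoʳ-≤ ∣ f zero - g zero ∣ (prodFin-distance n (unitF ∘ suc) (unitG ∘ suc)) ⟩
  ∣ f zero - g zero ∣ + sumFin n (λ i → ∣ f (suc i) - g (suc i) ∣) ∎
  where open ≤-Reasoning

-- The two indicator values compatible with a position: a tie may go either way.
upper lower : Position → ℚ
upper above = 0ℚ
upper _     = 1ℚ
lower below = 1ℚ
lower _     = 0ℚ

value-unit : ∀ p → InUnit (value p)
value-unit below = 0≤1 , ≤-refl
value-unit tie   = 0≤½ , ½≤1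
value-unit above = ≤-refl , 0≤1

upper-unit : ∀ p → InUnit (upper p)
upper-unit below = 0≤1 , ≤-refl
upper-unit tie   = 0≤1 , ≤-refl
upper-unit above = ≤-refl , 0≤1

lower-unit : ∀ p → InUnit (lower p)
lower-unit below = 0≤1 , ≤-refl
lower-unit tie   = ≤-refl , 0≤1
lower-unit above = ≤-refl , 0≤1

upper-error : ∀ p → ∣ upper p - value p ∣ ≡ ½ * tieIndicator p
upper-error below = refl
upper-error tie   = refl
upper-error above = refl

lower-error : ∀ p → ∣ lower p - value p ∣ ≡ ½ * tieIndicator p
lower-error below = refl
lower-error tie   = refl
lower-error above = refl

rounding-bound : ∀ d (c : Fin d → Position) (b : Position → ℚ) →
  (∀ p → InUnit (b p)) → (∀ p → ∣ b p - value p ∣ ≡ ½ * tieIndicator p) →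
  ∣ prodFin d (b ∘ c) - prodFin d (value ∘ c) ∣ ≤ sumFin d (λ j → ½ * tieIndicator (c j))
rounding-bound d c b unit error = begin
  ∣ prodFin d (b ∘ c) - prodFin d (value ∘ c) ∣ ≤⟨ prodFin-distance d (unit ∘ c) (value-unit ∘ c) ⟩
  sumFin d (λ j → ∣ b (c j) - value (c j) ∣)    ≡⟨ sumFin-cong d (error ∘ c) ⟩
  sumFin d (λ j → ½ * tieIndicator (c j))       ∎
  where open ≤-Reasoning

-- `below` is decidable, so a coordinate that is not below can be exhibited.
below? : (p : Position) → Dec (p ≡ below)
below? below = yes refl
below? tie   = no (λ ())
below? above = no (λ ())

-- The indicator χ of a proposition P (a box membership) that rules out
-- `above` coordinates and follows from all coordinates being `below` is
-- approximated by the product of the values up to ½ per tie: χ is the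
-- product of the upper indicators when P holds, of the lower ones otherwise.
indicator-approximation : ∀ d (c : Fin d → Position) {P : Set} →
  (P → ∀ j → c j ≢ above) → ((∀ j → c j ≡ below) → P) →
  ∀ χ → (P × χ ≡ 1ℚ) ⊎ (¬ P × χ ≡ 0ℚ) →
  ∣ χ - prodFin d (value ∘ c) ∣ ≤ sumFin d (λ j → ½ * tieIndicator (c j))
indicator-approximation d c noAbove allBelow χ (inj₁ (holds , refl)) =
  subst (λ χ → ∣ χ - prodFin d (value ∘ c) ∣ ≤ sumFin d (λ j → ½ * tieIndicator (c j)))
        (prodFin-ones d (λ j → upper-notAbove (c j) (noAbove holds j)))
        (rounding-bound d c upper upper-unit upper-error)
  where
  upper-notAbove : ∀ p → p ≢ above → upper p ≡ 1ℚ
  upper-notAbove below _      = refl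
  upper-notAbove tie   _      = refl
  upper-notAbove above ¬above = ⊥-elim (¬above refl)
indicator-approximation d c noAbove allBelow χ (inj₂ (fails , refl))
  with ¬∀⟶∃¬ d (λ j → c j ≡ below) (below? ∘ c) (fails ∘ allBelow)
... | j , notBelow =
  subst (λ χ → ∣ χ - prodFin d (value ∘ c) ∣ ≤ sumFin d (λ j → ½ * tieIndicator (c j)))
        (prodFin-zero d j (lower-notBelow (c j) notBelow))
        (rounding-bound d c lower lower-unit lower-error)
  where
  lower-notBelow : ∀ p → p ≢ below → lower p ≡ 0ℚ
  lower-notBelow below ¬below = ⊥-elim (¬below refl)
  lower-notBelow tie   _      = refl
  lower-notBelow above _      = refl

chiS-product : ∀ s d (X Y : Fin d → U) →
  chiS s d X Y ≡ prodFin d (λ j → value (position s (X j) (Y j)))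
chiS-product s d X Y = begin
  chiS s d X Y
    ≡⟨ cong ((1ℤ / (2 ^ d)) {{m^n≢0 2 d}} *_)
            (signed-sum-factorises s d (λ j a → boolℚ (inΠ (toℕ a) (oplusDigits s (X j) (Y j))))
                                       (λ j a → r (toℕ a) (Y j))) ⟩
  (1ℤ / (2 ^ d)) {{m^n≢0 2 d}} * prodFin d (λ j → digitSum s (X j) (Y j))
    ≡⟨ cong (_* prodFin d (λ j → digitSum s (X j) (Y j))) (unitFraction-2^ d) ⟩
  prodFin d (λ _ → ½) * prodFin d (λ j → digitSum s (X j) (Y j))
    ≡⟨ sym (prodFin-* d _ _) ⟩
  prodFin d (λ j → ½ * digitSum s (X j) (Y j))
    ≡⟨ prodFin-cong d (λ j → half-digitSum s (X j) (Y j)) ⟩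
  prodFin d (λ j → value (position s (X j) (Y j))) ∎
  where open ≡-Reasoning

lemma4p2 : (s d : ℕ) → 1 Data.Nat.≤ d → (X Y : Fin d → U) →
    (0ℚ Data.Rational.≤ chiS s d X Y) × (chiS s d X Y Data.Rational.≤ 1ℚ) ×
    ((χB : ℚ) → IsChiB d X Y χB →
      ∣ χB - chiS s d X Y ∣ Data.Rational.≤ ½ * sumFin d (λ j → δ s (X j) (Y j)))
lemma4p2 s d _ X Y = proj₁ chiS-unit , proj₂ chiS-unit , error-bound
  where
  c : Fin d → Position
  c j = position s (X j) (Y j)

  chiS-unit : InUnit (chiS s d X Y)
  chiS-unit = subst InUnit (sym (chiS-product s d X Y)) (prodFin-unit d (value-unit ∘ c))

  error-bound : (χB : ℚ) → IsChiB d X Y χB →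
    ∣ χB - chiS s d X Y ∣ ≤ ½ * sumFin d (λ j → δ s (X j) (Y j))
  error-bound χB isChi = begin
    ∣ χB - chiS s d X Y ∣               ≡⟨ cong (λ q → ∣ χB - q ∣) (chiS-product s d X Y) ⟩
    ∣ χB - prodFin d (value ∘ c) ∣      ≤⟨ indicator-approximation d c
         (λ inB j isAbove → above⇒¬≺ s (η (X j)) (η (Y j)) isAbove (inB j))
         (λ allBelow j → below⇒≺ s (η (X j)) (η (Y j)) (allBelow j)) χB isChi ⟩
    sumFin d (λ j → ½ * tieIndicator (c j)) ≡⟨ sumFin-*ˡ d ½ (tieIndicator ∘ c) ⟩
    ½ * sumFin d (tieIndicator ∘ c)     ≡⟨ cong (½ *_) (sumFin-cong d (λ j →
                                             sym (firstEq-tie s (η (X j)) (η (Y j))))) ⟩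
    ½ * sumFin d (λ j → δ s (X j) (Y j)) ∎
    where open ≤-Reasoning
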